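{- Let $T$ be a pre-Galois word that has an odd period, and let $p_o$ be the shortest odd period of $T$. Then $T[1..p_o]$ is a Galois word.
   Context: An integer $p\in[1..|W|]$ is a period of $W$ if $W[i+p]=W[i]$ for all $i\in[1..|W|-p]$. Alternating order: for words $S,T$ with $S^\omega\neq T^\omega$ ($X^\omega$ the infinite repetition of $X$), let $j$ be the first position with $S^\omega[j]\neq T^\omega[j]$; $S\prec_{\mathrm{alt}}T$ if $j$ is odd and $S^\omega[j]<T^\omega[j]$, or $j$ is even and $S^\omega[j]>T^\omega[j]$. $S=_{\mathrm{alt}}T$ if $S^\omega=T^\omega$; $\varepsilon\succ_{\mathrm{alt}}X$ for every nonempty $X$. A word is Galois if it is strictly smaller with respect to $\prec_{\mathrm{alt}}$ than all its other cyclic rotations (in particular it is primitive). A word $T$ is pre-Galois if every proper suffix $S$ of $T$ is a prefix of $T$ or satisfies $S\succ_{\mathrm{alt}}T$. -}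

module Defs where

open import Data.Nat using (ℕ; zero; suc; _+_; _<_; _≤_; _%_; _>_)
open import Data.Nat.Properties using ()
open import Data.List using (List; []; _∷_; length; take; drop; _++_)
open import Data.Maybe using (Maybe; just; nothing)
open import Data.Product using (Σ; _×_; _,_; ∃)
open import Data.Sum using (_⊎_)
open import Data.Empty using (⊥)
open import Data.Unit using (⊤)
open import Relation.Binary.PropositionalEquality using (_≡_; _≢_)
open import Data.List.Relation.Binary.Prefix.Heterogeneous using (Prefix)

Word : Set
Word = List ℕ

-- 0-based letter access: W ! i = just W[i+1] if i < |W|, else nothing.
_!_ : Word → ℕ → Maybe ℕ
[]       ! _       = nothing
(x ∷ xs) ! zero    = just x
(x ∷ xs) ! (suc i) = xs ! i

-- p is a period of W (1-based in the paper: p ∈ [1..|W|] and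
-- W[i+p] = W[i] for all i ∈ [1..|W|-p]; here with 0-based positions).
IsPeriod : ℕ → Word → Set
IsPeriod p W = (1 ≤ p) × (p ≤ length W) ×
  (∀ i → i + p < length W → W ! (i + p) ≡ W ! i)

Odd : ℕ → Set
Odd n = n % 2 ≡ 1

Even : ℕ → Set
Even n = n % 2 ≡ 0

IsShortestOddPeriod : ℕ → Word → Set
IsShortestOddPeriod p W = IsPeriod p W × Odd p ×
  (∀ q → IsPeriod q W → Odd q → p ≤ q)

-- Letter at 0-based position j of the infinite word X^ω, for nonempty X.
ω-at : (x : ℕ) (xs : List ℕ) → ℕ → ℕ
ω-at x xs j with (x ∷ xs) ! (j % length (x ∷ xs))
... | just c  = c
... | nothing = x   -- unreachable

-- With 0-based position j of the first difference of S^ω and T^ω, the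
-- paper's 1-based position is j+1, so "odd" there is "even j" here.
_≺alt_ : Word → Word → Set
[]       ≺alt _        = ⊥
(_ ∷ _)  ≺alt []       = ⊤
(s ∷ ss) ≺alt (t ∷ ts) = ∃ λ j →
    (∀ k → k < j → ω-at s ss k ≡ ω-at t ts k)
  × ((Even j × ω-at s ss j < ω-at t ts j)
     ⊎ (Odd j × ω-at s ss j > ω-at t ts j))

rot : ℕ → Word → Word
rot k W = drop k W ++ take k W

IsGalois : Word → Set
IsGalois W = ∀ k → 0 < k → k < length W → W ≺alt rot k W

IsPrefixOf : Word → Word → Set
IsPrefixOf = Prefix _≡_

IsPreGalois : Word → Set
IsPreGalois T = ∀ k → 1 ≤ k → k ≤ length T →
  IsPrefixOf (drop k T) T ⊎ T ≺alt drop k T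

{-# OPTIONS --safe #-}
-- Let W = T[1..p] and u = W^ω, of which T is a prefix. Comparing W with its rotation by k
-- means comparing u with u shifted by k. These differ before position p, since otherwise u
-- would be invariant under the shifts k and p − k, one of which is an odd period of T
-- shorter than p. Let j be the first mismatch. If j + k < |T| it lies inside T, and the
-- pre-Galois property for the suffix at k gives the comparison. Otherwise k is even (an odd
-- k would be a shorter odd period), and the mismatch reappears between T and its suffix at
-- the odd shift q = p − k, at position j − q, where the odd offset reverses the order.
module Submission where

open import Defs
open import Data.Nat using (ℕ; zero; suc; _+_; _∸_; _*_; _<_; _≤_; _>_; _%_; s≤s; NonZero; >-nonZero; _<?_)
open import Data.Nat.Properties
open import Data.Nat.DivMod
open import Data.Nat.Divisibility using (∣-refl)
open import Data.List using ([]; _∷_; length; take; drop; _++_)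
open import Data.List.Properties using (length-++; length-drop; length-take; take++drop≡id)
open import Data.List.Relation.Binary.Prefix.Heterogeneous using (Prefix; _∷_)
open import Data.Maybe using (just)
open import Data.Maybe.Properties using (just-injective)
open import Data.Product using (∃; _×_; _,_; proj₁; proj₂)
open import Data.Sum using (_⊎_; inj₁; inj₂; [_,_]′)
open import Data.Empty using (⊥-elim)
open import Relation.Nullary using (¬_; yes; no)
open import Relation.Binary.PropositionalEquality
open import Relation.Binary.Definitions using (tri<; tri≈; tri>)

variable
  i j j′ k p s : ℕ
  f f′ g g′ : ℕ → ℕ
  T X Y : Word

-- Total letter access, with junk value 0 past the end.
at : Word → ℕ → ℕ
at []       _       = 0
at (x ∷ xs) zero    = x
at (x ∷ xs) (suc i) = at xs i

!-at : ∀ (X : Word) → i < length X → X ! i ≡ just (at X i)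
!-at {zero}  (x ∷ xs) _         = refl
!-at {suc i} (x ∷ xs) (s≤s i<n) = !-at xs i<n

at-take : ∀ p (X : Word) → i < p → at (take p X) i ≡ at X i
at-take         (suc p) []       _         = refl
at-take {zero}  (suc p) (x ∷ xs) _         = refl
at-take {suc i} (suc p) (x ∷ xs) (s≤s i<p) = at-take p xs i<p

at-drop : ∀ k (X : Word) i → at (drop k X) i ≡ at X (k + i)
at-drop zero    X        i = refl
at-drop (suc k) []       i = refl
at-drop (suc k) (x ∷ xs) i = at-drop k xs i

at-++ˡ : ∀ (X Y : Word) → i < length X → at (X ++ Y) i ≡ at X i
at-++ˡ {zero}  (x ∷ xs) Y _         = refl
at-++ˡ {suc i} (x ∷ xs) Y (s≤s i<n) = at-++ˡ xs Y i<n

at-++ʳ : ∀ (X Y : Word) i → at (X ++ Y) (length X + i) ≡ at Y i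
at-++ʳ []       Y i = refl
at-++ʳ (x ∷ xs) Y i = at-++ʳ xs Y i

at-prefix : Prefix _≡_ X Y → i < length X → at X i ≡ at Y i
at-prefix {i = zero}  (x≡y ∷ _)  _         = x≡y
at-prefix {i = suc i} (_ ∷ rest) (s≤s i<n) = at-prefix rest i<n

length-rot : ∀ k (X : Word) → length (rot k X) ≡ length X
length-rot k X = begin
  length (drop k X ++ take k X)           ≡⟨ length-++ (drop k X) ⟩
  length (drop k X) + length (take k X)   ≡⟨ +-comm (length (drop k X)) _ ⟩
  length (take k X) + length (drop k X)   ≡⟨ length-++ (take k X) ⟨
  length (take k X ++ drop k X)           ≡⟨ cong length (take++drop≡id k X) ⟩
  length X                                ∎
  where open ≡-Reasoning

m+[n∸m+o]≡n+o : ∀ {m n} o → m ≤ n → m + (n ∸ m + o) ≡ n + o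
m+[n∸m+o]≡n+o {m} {n} o m≤n = trans (sym (+-assoc m (n ∸ m) o)) (cong (_+ o) (m+[n∸m]≡n m≤n))

at-rot : .{{_ : NonZero p}} → length X ≡ p → k ≤ p → i < p →
         at (rot k X) i ≡ at X ((k + i) % p)
at-rot {p} {X} {k} {i} |X|≡p k≤p i<p with i <? length (drop k X)
... | yes i<ℓ = begin
  at (drop k X ++ take k X) i   ≡⟨ at-++ˡ (drop k X) (take k X) i<ℓ ⟩
  at (drop k X) i               ≡⟨ at-drop k X i ⟩
  at X (k + i)                  ≡⟨ cong (at X) (m<n⇒m%n≡m k+i<p) ⟨
  at X ((k + i) % p)            ∎
  where
    open ≡-Reasoning
    k+i<p : k + i < p
    k+i<p = subst (k + i <_) (m+[n∸m]≡n k≤p)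
              (+-monoʳ-< k (subst (i <_) (trans (length-drop k X) (cong (_∸ k) |X|≡p)) i<ℓ))
... | no i≮ℓ = begin
  at (drop k X ++ take k X) i              ≡⟨ cong (at (drop k X ++ take k X)) i≡ℓ+i′ ⟩
  at (drop k X ++ take k X) (ℓ + i′)       ≡⟨ at-++ʳ (drop k X) (take k X) i′ ⟩
  at (take k X) i′                         ≡⟨ at-take k X i′<k ⟩
  at X i′                                  ≡⟨ cong (at X) (m<n⇒m%n≡m (<-≤-trans i′<k k≤p)) ⟨
  at X (i′ % p)                            ≡⟨ cong (at X) ([m+n]%n≡m%n i′ p) ⟨
  at X ((i′ + p) % p)                      ≡⟨ cong (λ m → at X (m % p)) (+-comm i′ p) ⟩
  at X ((p + i′) % p)                      ≡⟨ cong (λ m → at X (m % p)) k+i≡p+i′ ⟨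
  at X ((k + i) % p)                       ∎
  where
    open ≡-Reasoning
    ℓ = length (drop k X)
    i′ = i ∸ ℓ
    ℓ≡p∸k : ℓ ≡ p ∸ k
    ℓ≡p∸k = trans (length-drop k X) (cong (_∸ k) |X|≡p)
    ℓ+i′≡i : ℓ + i′ ≡ i
    ℓ+i′≡i = m+[n∸m]≡n (≮⇒≥ i≮ℓ)
    i≡ℓ+i′ : i ≡ ℓ + i′
    i≡ℓ+i′ = sym ℓ+i′≡i
    i′<k : i′ < k
    i′<k = +-cancelˡ-< ℓ i′ k (subst₂ _<_ i≡ℓ+i′ (trans (sym (m∸n+n≡m k≤p)) (cong (_+ k) (sym ℓ≡p∸k))) i<p)
    k+i≡p+i′ : k + i ≡ p + i′
    k+i≡p+i′ = trans (cong (k +_) (trans i≡ℓ+i′ (cong (_+ i′) ℓ≡p∸k))) (m+[n∸m+o]≡n+o i′ k≤p)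

ω-at-< : ∀ x xs → j < length (x ∷ xs) → ω-at x xs j ≡ at (x ∷ xs) j
ω-at-< {j} x xs j<n with (x ∷ xs) ! (j % length (x ∷ xs)) | !-at (x ∷ xs) (m%n<n j (length (x ∷ xs)))
... | just c | letter≡ = trans (just-injective letter≡) (cong (at (x ∷ xs)) (m<n⇒m%n≡m j<n))

IsPeriod⇒at : IsPeriod p T → i + p < length T → at T (i + p) ≡ at T i
IsPeriod⇒at {p} {T} {i} (_ , _ , period) i+p<n = just-injective (begin
  just (at T (i + p))   ≡⟨ !-at T i+p<n ⟨
  T ! (i + p)           ≡⟨ period i i+p<n ⟩
  T ! i                 ≡⟨ !-at T (≤-<-trans (m≤m+n i p) i+p<n) ⟩
  just (at T i)         ∎)
  where open ≡-Reasoning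

at⇒IsPeriod : 1 ≤ p → p ≤ length T → (∀ i → i + p < length T → at T (i + p) ≡ at T i) →
              IsPeriod p T
at⇒IsPeriod {p} {T} 1≤p p≤n period = 1≤p , p≤n , λ i i+p<n → begin
  T ! (i + p)           ≡⟨ !-at T i+p<n ⟩
  just (at T (i + p))   ≡⟨ cong just (period i i+p<n) ⟩
  just (at T i)         ≡⟨ !-at T (≤-<-trans (m≤m+n i p) i+p<n) ⟨
  T ! i                 ∎
  where open ≡-Reasoning

at-+multiple : IsPeriod p T → ∀ q → i + q * p < length T → at T (i + q * p) ≡ at T i
at-+multiple {p} {T} {i} period zero    _        = cong (at T) (+-identityʳ i)
at-+multiple {p} {T} {i} period (suc q) i+[1+q]p<n = begin
  at T (i + (p + q * p))   ≡⟨ cong (at T) reassoc ⟩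
  at T (i + q * p + p)     ≡⟨ IsPeriod⇒at {T = T} period i+qp+p<n ⟩
  at T (i + q * p)         ≡⟨ at-+multiple {T = T} period q (≤-<-trans (m≤m+n (i + q * p) p) i+qp+p<n) ⟩
  at T i                   ∎
  where
    open ≡-Reasoning
    reassoc : i + (p + q * p) ≡ i + q * p + p
    reassoc = trans (cong (i +_) (+-comm p (q * p))) (sym (+-assoc i (q * p) p))
    i+qp+p<n : i + q * p + p < length T
    i+qp+p<n = subst (_< length T) reassoc i+[1+q]p<n

at-%-period : .{{_ : NonZero p}} → IsPeriod p T → i < length T → at T i ≡ at T (i % p)
at-%-period {p} {T} {i} period i<n =
  trans (cong (at T) i≡) (at-+multiple {T = T} period (i / p) (subst (_< length T) i≡ i<n))
  where
    i≡ : i ≡ i % p + (i / p) * p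
    i≡ = m≡m%n+[m/n]*n i p

even⊎odd : ∀ n → Even n ⊎ Odd n
even⊎odd n with n % 2 | m%n<n n 2
... | 0           | _                 = inj₁ refl
... | 1           | _                 = inj₂ refl
... | suc (suc _) | s≤s (s≤s ())

%2-+ : ∀ {a b x y} → a % 2 ≡ x → b % 2 ≡ y → (a + b) % 2 ≡ (x + y) % 2
%2-+ {a} {b} a%2≡x b%2≡y = trans (%-distribˡ-+ a b 2) (cong₂ (λ u v → (u + v) % 2) a%2≡x b%2≡y)

odd∸even : k ≤ p → Odd p → Even k → Odd (p ∸ k)
odd∸even {k} {p} k≤p odd-p even-k with even⊎odd (p ∸ k)
... | inj₂ odd = odd
... | inj₁ even with trans (sym odd-p) (subst Even (m∸n+n≡m k≤p) (%2-+ {p ∸ k} {k} even even-k))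
...   | ()

AgreeBelow : ℕ → (ℕ → ℕ) → (ℕ → ℕ) → Set
AgreeBelow j f g = ∀ i → i < j → f i ≡ g i

FirstMismatch : (ℕ → ℕ) → (ℕ → ℕ) → ℕ → Set
FirstMismatch f g j = AgreeBelow j f g × f j ≢ g j

AltLess : ℕ → ℕ → ℕ → Set
AltLess j a b = (Even j × a < b) ⊎ (Odd j × a > b)

AltLessAt : (ℕ → ℕ) → (ℕ → ℕ) → ℕ → Set
AltLessAt f g j = AgreeBelow j f g × AltLess j (f j) (g j)

AltLess⇒≢ : ∀ {a b} → AltLess j a b → a ≢ b
AltLess⇒≢ (inj₁ (_ , a<b)) refl = <-irrefl refl a<b
AltLess⇒≢ (inj₂ (_ , a>b)) refl = <-irrefl refl a>b

AltLess-flip : ∀ {q a b} → Odd q → AltLess i b a → AltLess (i + q) a b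
AltLess-flip {i} {q} odd-q (inj₁ (even-i , b<a)) = inj₂ (%2-+ {i} {q} even-i odd-q , b<a)
AltLess-flip {i} {q} odd-q (inj₂ (odd-i , b>a))  = inj₁ (%2-+ {i} {q} odd-i odd-q , b>a)

firstMismatch-unique : FirstMismatch f g j → FirstMismatch f g j′ → j ≡ j′
firstMismatch-unique {j = j} {j′ = j′} (agree , differ) (agree′ , differ′) with <-cmp j j′
... | tri< j<j′ _ _ = ⊥-elim (differ (agree′ j j<j′))
... | tri≈ _ j≡j′ _ = j≡j′
... | tri> _ _ j′<j = ⊥-elim (differ′ (agree j′ j′<j))

agreeBelow⊎firstMismatch : ∀ f g N → AgreeBelow N f g ⊎ ∃ λ j → j < N × FirstMismatch f g j
agreeBelow⊎firstMismatch f g zero = inj₁ (λ _ ())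
agreeBelow⊎firstMismatch f g (suc N) with agreeBelow⊎firstMismatch f g N
... | inj₂ (j , j<N , mismatch) = inj₂ (j , m<n⇒m<1+n j<N , mismatch)
... | inj₁ agree with f N ≟ g N
...   | no differ = inj₂ (N , n<1+n N , agree , differ)
...   | yes same  = inj₁ λ i i<1+N → [ agree i , (λ { refl → same }) ]′ (m<1+n⇒m<n∨m≡n i<1+N)

EqUpTo : ℕ → (ℕ → ℕ) → (ℕ → ℕ) → Set
EqUpTo j f f′ = ∀ {i} → i ≤ j → f i ≡ f′ i

AgreeBelow-cong : EqUpTo j f f′ → EqUpTo j g g′ → AgreeBelow j f g → AgreeBelow j f′ g′
AgreeBelow-cong f≡ g≡ agree i i<j =
  trans (sym (f≡ (<⇒≤ i<j))) (trans (agree i i<j) (g≡ (<⇒≤ i<j)))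

FirstMismatch-cong : EqUpTo j f f′ → EqUpTo j g g′ → FirstMismatch f g j → FirstMismatch f′ g′ j
FirstMismatch-cong f≡ g≡ (agree , differ) =
  AgreeBelow-cong f≡ g≡ agree , λ same → differ (trans (f≡ ≤-refl) (trans same (sym (g≡ ≤-refl))))

AltLessAt-cong : EqUpTo j f f′ → EqUpTo j g g′ → AltLessAt f g j → AltLessAt f′ g′ j
AltLessAt-cong {j} f≡ g≡ (agree , less) =
  AgreeBelow-cong f≡ g≡ agree , subst₂ (AltLess j) (f≡ ≤-refl) (g≡ ≤-refl) less

ω-at-EqUpTo : ∀ x xs → j < length (x ∷ xs) → EqUpTo j (at (x ∷ xs)) (ω-at x xs)
ω-at-EqUpTo x xs j<n i≤j = sym (ω-at-< x xs (≤-<-trans i≤j j<n))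

≺alt-intro : ∀ (X Y : Word) → j < length X → j < length Y → AltLessAt (at X) (at Y) j → X ≺alt Y
≺alt-intro {j} (x ∷ xs) (y ∷ ys) j<X j<Y less =
  j , AltLessAt-cong (ω-at-EqUpTo x xs j<X) (ω-at-EqUpTo y ys j<Y) less

≺alt-elim : ∀ (X Y : Word) → j < length X → j < length Y → FirstMismatch (at X) (at Y) j →
            X ≺alt Y → AltLess j (at X j) (at Y j)
≺alt-elim {j} (x ∷ xs) (y ∷ ys) j<X j<Y mismatch (j′ , less′)
  with firstMismatch-unique mismatchω (proj₁ less′ , AltLess⇒≢ {j′} (proj₂ less′))
  where
    mismatchω : FirstMismatch (ω-at x xs) (ω-at y ys) j
    mismatchω = FirstMismatch-cong (ω-at-EqUpTo x xs j<X) (ω-at-EqUpTo y ys j<Y) mismatch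
... | refl = subst₂ (AltLess j) (ω-at-< x xs j<X) (ω-at-< y ys j<Y) (proj₂ less′)

preGalois-firstMismatch : IsPreGalois T → 1 ≤ k → j + k < length T →
  FirstMismatch (at T) (λ i → at T (k + i)) j → AltLess j (at T j) (at T (k + j))
preGalois-firstMismatch {T} {k} {j} preGalois 1≤k j+k<n mismatch =
  [ (λ prefix → ⊥-elim (proj₂ mismatch (trans (sym (at-prefix prefix j<S)) (at-drop k T j))))
  , (λ T≺S → subst (AltLess j (at T j)) (at-drop k T j) (≺alt-elim T (drop k T) j<n j<S mismatchS T≺S))
  ]′ (preGalois k 1≤k (≤-trans (m≤n+m k j) (<⇒≤ j+k<n)))
  where
    j<n : j < length T
    j<n = ≤-<-trans (m≤m+n j k) j+k<n
    j<S : j < length (drop k T)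
    j<S = subst (j <_) (sym (length-drop k T)) (m+n≤o⇒m≤o∸n (suc j) j+k<n)
    mismatchS : FirstMismatch (at T) (at (drop k T)) j
    mismatchS = FirstMismatch-cong (λ _ → refl) (λ {i} _ → sym (at-drop k T i)) mismatch

module ShortestOddPeriod {T : Word} (preGalois : IsPreGalois T) {p : ℕ}
                         (shortest : IsShortestOddPeriod p T) where

  period : IsPeriod p T
  period = proj₁ shortest

  instance
    p≢0 : NonZero p
    p≢0 = >-nonZero (proj₁ period)

  p≤n : p ≤ length T
  p≤n = proj₁ (proj₂ period)

  W : Word
  W = take p T

  |W|≡p : length W ≡ p
  |W|≡p = trans (length-take p T) (m≤n⇒m⊓n≡m p≤n)

  u : ℕ → ℕ
  u t = at W (t % p)

  u≡at : i < length T → u i ≡ at T i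
  u≡at {i} i<n = trans (at-take p T (m%n<n i p)) (sym (at-%-period {T = T} period i<n))

  u-+% : ∀ k i → u (k + i % p) ≡ u (k + i)
  u-+% k i = cong (at W) (begin
    (k + i % p) % p             ≡⟨ %-distribˡ-+ k (i % p) p ⟩
    (k % p + i % p % p) % p     ≡⟨ cong (λ m → (k % p + m) % p) (m%n%n≡m%n i p) ⟩
    (k % p + i % p) % p         ≡⟨ %-distribˡ-+ k i p ⟨
    (k + i) % p                 ∎)
    where open ≡-Reasoning

  u-complement : k ≤ p → ∀ i → u (k + (p ∸ k + i)) ≡ u i
  u-complement k≤p i = trans (cong u (m+[n∸m+o]≡n+o i k≤p)) (cong (at W) (%-remove-+ˡ i ∣-refl))

  agreeBelow-p⇒invariant : AgreeBelow p u (λ i → u (k + i)) → ∀ i → u (k + i) ≡ u i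
  agreeBelow-p⇒invariant {k} agree i = begin
    u (k + i)       ≡⟨ u-+% k i ⟨
    u (k + i % p)   ≡⟨ agree (i % p) (m%n<n i p) ⟨
    u (i % p)       ≡⟨ u-+% 0 i ⟩
    u i             ∎
    where open ≡-Reasoning

  noShorterOddPeriod : ∀ {q} → 1 ≤ q → q < p → Odd q →
                       ¬ (∀ i → i + q < length T → u (q + i) ≡ u i)
  noShorterOddPeriod {q} 1≤q q<p odd-q shift =
    <⇒≱ q<p (proj₂ (proj₂ shortest) q (at⇒IsPeriod {T = T} 1≤q (≤-trans (<⇒≤ q<p) p≤n) periodAt) odd-q)
    where
      periodAt : ∀ i → i + q < length T → at T (i + q) ≡ at T i
      periodAt i i+q<n = begin
        at T (i + q)   ≡⟨ u≡at i+q<n ⟨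
        u (i + q)      ≡⟨ cong u (+-comm i q) ⟩
        u (q + i)      ≡⟨ shift i i+q<n ⟩
        u i            ≡⟨ u≡at (≤-<-trans (m≤m+n i q) i+q<n) ⟩
        at T i         ∎
        where open ≡-Reasoning

  complement-odd : Even k → k < p → Odd (p ∸ k)
  complement-odd even-k k<p = odd∸even (<⇒≤ k<p) (proj₁ (proj₂ shortest)) even-k

  ¬shiftInvariant : 1 ≤ k → k < p → ¬ (∀ i → u (k + i) ≡ u i)
  ¬shiftInvariant {k} 1≤k k<p invariant with even⊎odd k
  ... | inj₂ odd-k  = noShorterOddPeriod 1≤k k<p odd-k (λ i _ → invariant i)
  ... | inj₁ even-k = noShorterOddPeriod (m+n≤o⇒m≤o∸n 1 k<p) (∸-monoʳ-< 1≤k (<⇒≤ k<p))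
                        (complement-odd even-k k<p)
                        (λ i _ → trans (sym (invariant (p ∸ k + i))) (u-complement (<⇒≤ k<p) i))

  firstMismatch-inside : 1 ≤ s → j + s < length T → FirstMismatch u (λ i → u (s + i)) j →
                         AltLess j (u j) (u (s + j))
  firstMismatch-inside {s} {j} 1≤s j+s<n mismatch =
    subst₂ (AltLess j) (sym (u≡at j<n)) (sym (u≡at s+j<n))
      (preGalois-firstMismatch {T = T} preGalois 1≤s j+s<n
        (FirstMismatch-cong (λ i≤j → u≡at (≤-<-trans i≤j j<n))
                            (λ i≤j → u≡at (≤-<-trans (+-monoʳ-≤ s i≤j) s+j<n)) mismatch))
    where
      j<n : j < length T
      j<n = ≤-<-trans (m≤m+n j s) j+s<n
      s+j<n : s + j < length T
      s+j<n = subst (_< length T) (+-comm j s) j+s<n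

  firstMismatch-complement : k ≤ p → p ∸ k ≤ j → FirstMismatch u (λ i → u (k + i)) j →
                             FirstMismatch u (λ i → u (p ∸ k + i)) (j ∸ (p ∸ k))
  firstMismatch-complement {k} {j} k≤p q≤j (agree , differ) = agreeQ , differQ
    where
      q = p ∸ k
      i₀ = j ∸ q
      q+i₀≡j : q + i₀ ≡ j
      q+i₀≡j = m+[n∸m]≡n q≤j
      agreeQ : AgreeBelow i₀ u (λ i → u (q + i))
      agreeQ i i<i₀ = trans (sym (u-complement k≤p i))
        (sym (agree (q + i) (subst (q + i <_) q+i₀≡j (+-monoʳ-< q i<i₀))))
      differQ : u i₀ ≢ u (q + i₀)
      differQ same = differ (begin
        u j                 ≡⟨ cong u q+i₀≡j ⟨
        u (q + i₀)          ≡⟨ same ⟨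
        u i₀                ≡⟨ u-complement k≤p i₀ ⟨
        u (k + (q + i₀))    ≡⟨ cong (λ m → u (k + m)) q+i₀≡j ⟩
        u (k + j)           ∎)
        where open ≡-Reasoning

  firstMismatch-wrapped : Even k → k < p → j < p → length T ≤ j + k →
                          FirstMismatch u (λ i → u (k + i)) j → AltLess j (u j) (u (k + j))
  firstMismatch-wrapped {k} {j} even-k k<p j<p n≤j+k mismatch =
    subst (λ m → AltLess m (u m) (u (k + m))) i₀+q≡j
      (subst₂ (AltLess (i₀ + q)) (cong u (+-comm q i₀)) (sym u[k+i₀+q]≡u[i₀])
        (AltLess-flip {i₀} {q} (complement-odd even-k k<p)
          (firstMismatch-inside (m+n≤o⇒m≤o∸n 1 k<p) i₀+q<n
            (firstMismatch-complement (<⇒≤ k<p) q≤j mismatch))))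
    where
      q = p ∸ k
      q≤j : q ≤ j
      q≤j = m≤n+o⇒m∸n≤o p k (subst (p ≤_) (+-comm j k) (≤-trans p≤n n≤j+k))
      i₀ = j ∸ q
      i₀+q≡j : i₀ + q ≡ j
      i₀+q≡j = m∸n+n≡m q≤j
      i₀+q<n : i₀ + q < length T
      i₀+q<n = subst (_< length T) (sym i₀+q≡j) (<-≤-trans j<p p≤n)
      u[k+i₀+q]≡u[i₀] : u (k + (i₀ + q)) ≡ u i₀
      u[k+i₀+q]≡u[i₀] = trans (cong (λ m → u (k + m)) (+-comm i₀ q)) (u-complement (<⇒≤ k<p) i₀)

  firstMismatch⇒AltLess : 1 ≤ k → k < p → j < p → FirstMismatch u (λ i → u (k + i)) j →
                          AltLess j (u j) (u (k + j))
  firstMismatch⇒AltLess {k} {j} 1≤k k<p j<p mismatch with j + k <? length T | even⊎odd k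
  ... | yes j+k<n | _           = firstMismatch-inside 1≤k j+k<n mismatch
  ... | no j+k≮n  | inj₁ even-k = firstMismatch-wrapped even-k k<p j<p (≮⇒≥ j+k≮n) mismatch
  ... | no j+k≮n  | inj₂ odd-k  = ⊥-elim (noShorterOddPeriod 1≤k k<p odd-k λ i i+k<n →
          sym (proj₁ mismatch i (+-cancelʳ-< k i j (<-≤-trans i+k<n (≮⇒≥ j+k≮n)))))

  u-AltLessAt : 1 ≤ k → k < p → ∃ λ j → j < p × AltLessAt u (λ i → u (k + i)) j
  u-AltLessAt {k} 1≤k k<p with agreeBelow⊎firstMismatch u (λ i → u (k + i)) p
  ... | inj₁ agree                = ⊥-elim (¬shiftInvariant 1≤k k<p (agreeBelow-p⇒invariant agree))
  ... | inj₂ (j , j<p , mismatch) =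
          j , j<p , proj₁ mismatch , firstMismatch⇒AltLess 1≤k k<p j<p mismatch

  W≺alt-rot : 1 ≤ k → k < p → W ≺alt rot k W
  W≺alt-rot {k} 1≤k k<p with u-AltLessAt 1≤k k<p
  ... | j , j<p , less = ≺alt-intro W (rot k W) j<|W| (subst (j <_) (sym (length-rot k W)) j<|W|)
          (AltLessAt-cong (λ i≤j → cong (at W) (m<n⇒m%n≡m (≤-<-trans i≤j j<p)))
                          (λ i≤j → sym (at-rot |W|≡p (<⇒≤ k<p) (≤-<-trans i≤j j<p))) less)
    where
      j<|W| : j < length W
      j<|W| = subst (j <_) (sym |W|≡p) j<p

  take-isGalois : IsGalois W
  take-isGalois k 1≤k k<|W| = W≺alt-rot 1≤k (subst (k <_) |W|≡p k<|W|)

lemma11 : (T : Word) → IsPreGalois T → (p : ℕ) → IsShortestOddPeriod p T →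
    IsGalois (take p T)
lemma11 T preGalois p shortest = ShortestOddPeriod.take-isGalois preGalois shortest
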